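{- Let $\lambda=(m,n)$ be a triangular $2$-partition, let $\tau=(\tau_1,\tau_2)$ be a subpartition of $\lambda$ on the right side, and let $\mu=(\mu_1,\mu_2)$ be a subpartition with $\tau\preceq\mu$ in the $\nu$-Tamari lattice of $\lambda$. Then $\mu$ is also on the right side and $\mathrm{dist}(\tau,\mu)=\tau_1-\mu_1$.
   Context: A $2$-partition $(m,n)$ has $m\ge n\ge0$; it is triangular if there exist positive reals $r,s$ with $\lambda_j=\lfloor r-jr/s\rfloor$ for $1\le j\le s$ and $\lambda_j=0$ for $j>s$ (for $2$-partitions: iff $n\le\lceil m/2\rceil$). A subpartition $\mu=(m-i,n-j)$ of $(m,n)$ is on the left side if $i<j$, in the center if $i=j$, on the right side if $i>j$. $\nu$-Tamari order: for a subpartition $\mu$ and a line $j$ (rows counted $1,2,\dots$ from the bottom) with $\mu_j>\mu_{j+1}$, let $v=\lambda_j-\mu_j$ and $i_0$ the smallest integer with $0\le i_0<j$ such that $\lambda_k-\mu_k>v$ for all $i_0<k<j$; the rotation at line $j$ gives $\alpha$ with $\alpha_k=\mu_k-1$ for $i_0<k\le j$, $\alpha_k=\mu_k$ otherwise; $\preceq$ is the reflexive-transitive closure of rotations. $\mathrm{dist}(\tau,\mu)$ is the length of a longest chain from $\tau$ to $\mu$. -}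

module Defs where

open import Data.Nat using (ℕ; zero; suc; _+_; _*_; _∸_; _≤_; _<_; _>_; _<?_; _≤?_)
open import Data.Product using (Σ; ∃; _×_; _,_; proj₁; proj₂)
open import Relation.Nullary using (¬_; yes; no)
open import Relation.Binary.PropositionalEquality using (_≡_; _≢_)
open import Relation.Binary.Construct.Closure.ReflexiveTransitive using (Star; ε; _◅_)

-- A 2-partition (a , b) is a pair of naturals with a ≥ b; rows are
-- counted 1, 2, … from the bottom: row 1 has length a, row 2 has length b.
Pair : Set
Pair = ℕ × ℕ

IsPartition2 : Pair → Set
IsPartition2 (a , b) = b ≤ a

part : Pair → ℕ → ℕ
part (a , b) 1 = a
part (a , b) 2 = b
part (a , b) _ = 0

-- triangular 2-partition: n ≤ ⌈m/2⌉, i.e. 2n ≤ m+1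
Triangular : Pair → Set
Triangular (m , n) = IsPartition2 (m , n) × 2 * n ≤ m + 1

Sub : Pair → Pair → Set
Sub (m , n) (a , b) = IsPartition2 (a , b) × a ≤ m × b ≤ n

RightSide : Pair → Pair → Set
RightSide (m , n) (a , b) = m ∸ a > n ∸ b

Gap : Pair → Pair → ℕ → ℕ → ℕ → Set
Gap la μ v i0 j = ∀ k → i0 < k → k < j → part la k ∸ part μ k > v

rotEntry : Pair → ℕ → ℕ → ℕ → ℕ
rotEntry μ i0 j k with i0 <? k | k ≤? j
... | yes _ | yes _ = part μ k ∸ 1
... | _     | _     = part μ k

Rot : Pair → Pair → Pair → Set
Rot la μ α =
  Σ ℕ λ j → Σ ℕ λ i0 →
    1 ≤ j × part μ j > part μ (suc j) ×
    i0 < j × Gap la μ (part la j ∸ part μ j) i0 j ×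
    (∀ i' → i' < i0 → ¬ Gap la μ (part la j ∸ part μ j) i' j) ×
    α ≡ (rotEntry μ i0 j 1 , rotEntry μ i0 j 2)

RotSub : Pair → Pair → Pair → Set
RotSub la μ α = Sub la μ × Sub la α × Rot la μ α

_⊢_≼_ : Pair → Pair → Pair → Set
la ⊢ τ ≼ μ = Star (RotSub la) τ μ

_⊢_≺_ : Pair → Pair → Pair → Set
la ⊢ τ ≺ μ = (la ⊢ τ ≼ μ) × τ ≢ μ

Chain : Pair → Pair → Pair → Set
Chain la τ μ = Star (la ⊢_≺_) τ μ

chainLength : ∀ {la τ μ} → Chain la τ μ → ℕ
chainLength ε = 0
chainLength (_ ◅ c) = suc (chainLength c)

Dist : Pair → Pair → Pair → ℕ → Set
Dist la τ μ d = (Σ (Chain la τ μ) λ c → chainLength c ≡ d)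
             × (∀ (c : Chain la τ μ) → chainLength c ≤ d)

-- A rotation of a subpartition on the right side is forced to start at i₀ = 0: the
-- gap condition at k = 1 is exactly the right-side inequality, so minimality of i₀
-- excludes i₀ = 1.  Hence every rotation lowers the first part by exactly one and
-- stays on the right side.  Along any chain the
-- first part therefore drops by at least one per strict step, and the rotations of
-- a given path τ ≼ μ form a chain of length exactly τ₁ − μ₁.
module Submission where

open import Defs
open import Data.Empty using (⊥-elim)
open import Data.Nat using (zero; suc; _+_; _∸_; _≤_; _<_; z≤n; s≤s)
open import Data.Nat.Properties
open import Data.Product using (Σ; _×_; _,_; proj₁; proj₂)
open import Relation.Binary.PropositionalEquality
  using (_≡_; refl; sym; trans; cong; subst; subst₂)
open import Relation.Binary.Construct.Closure.ReflexiveTransitive using (ε; _◅_)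

m∸n≡1+m∸1+n : ∀ {m n} → n < m → m ∸ n ≡ suc (m ∸ suc n)
m∸n≡1+m∸1+n {suc m} (s≤s n≤m) = +-∸-assoc 1 n≤m

RightSub : Pair → Pair → Set
RightSub la μ = Sub la μ × RightSide la μ

rot-rightSide : ∀ {la μ α} → RightSub la μ → Rot la μ α →
                RightSide la α × suc (proj₁ α) ≡ proj₁ μ
rot-rightSide _ (zero , _ , () , _)
rot-rightSide _ (1 , suc _ , _ , _ , s≤s () , _)
rot-rightSide {m , _} {suc a , _} (_ , rs) (1 , 0 , _ , _ , _ , _ , _ , refl) =
  ≤-trans rs (∸-monoʳ-≤ m (n≤1+n a)) , refl
rot-rightSide {_} {_ , zero} _ (2 , _ , _ , () , _)
rot-rightSide {m , n} {suc a , suc b} ((_ , a<m , b<n) , rs) (2 , 0 , _ , _ , _ , _ , _ , refl) =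
  subst₂ _<_ (sym (m∸n≡1+m∸1+n b<n)) (sym (m∸n≡1+m∸1+n a<m)) (s≤s rs) , refl
rot-rightSide {zero , _} {zero , suc _} ((() , _) , _) (2 , 0 , _)
rot-rightSide {m , n} {a , b} (_ , rs) (2 , 1 , _ , _ , _ , _ , minimal , _) =
  ⊥-elim (minimal 0 (s≤s z≤n) gap-from-0)
  where
  gap-from-0 : Gap (m , n) (a , b) (n ∸ b) 0 2
  gap-from-0 1 _ _ = rs
  gap-from-0 (suc (suc _)) _ (s≤s (s≤s ()))
rot-rightSide _ (2 , suc (suc _) , _ , _ , s≤s (s≤s ()) , _)
rot-rightSide _ (suc (suc (suc _)) , _ , _ , () , _)

rotSub-rightSub : ∀ {la μ α} → RightSub la μ → RotSub la μ α →
                  RightSub la α × suc (proj₁ α) ≡ proj₁ μ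
rotSub-rightSub inv (_ , subα , rot) with rot-rightSide inv rot
... | rsα , 1+α₁≡μ₁ = (subα , rsα) , 1+α₁≡μ₁

≼⇒chain : ∀ {la τ μ} → RightSub la τ → la ⊢ τ ≼ μ →
          RightSub la μ × Σ (Chain la τ μ) (λ c → chainLength c + proj₁ μ ≡ proj₁ τ)
≼⇒chain inv ε = inv , ε , refl
≼⇒chain inv (r ◅ p) with rotSub-rightSub inv r
... | invα , 1+α₁≡τ₁ with ≼⇒chain invα p
...   | invμ , c , len≡ =
  invμ , ((r ◅ ε) , λ τ≡α → 1+n≢n (trans 1+α₁≡τ₁ (cong proj₁ τ≡α))) ◅ c ,
  trans (cong suc len≡) 1+α₁≡τ₁

≺-descends : ∀ {la τ μ} → RightSub la τ → la ⊢ τ ≺ μ →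
             RightSub la μ × proj₁ μ < proj₁ τ
≺-descends inv (ε , τ≢τ) = ⊥-elim (τ≢τ refl)
≺-descends {μ = μ} inv (r ◅ p , _) with rotSub-rightSub inv r
... | invα , 1+α₁≡τ₁ with ≼⇒chain invα p
...   | invμ , c , len≡ =
  invμ , subst (proj₁ μ <_) 1+α₁≡τ₁ (s≤s (subst (proj₁ μ ≤_) len≡ (m≤n+m _ _)))

chainLength-bound : ∀ {la τ μ} → RightSub la τ → (c : Chain la τ μ) →
                    chainLength c + proj₁ μ ≤ proj₁ τ
chainLength-bound inv ε = ≤-refl
chainLength-bound inv (s ◅ c) with ≺-descends inv s
... | invα , α₁<τ₁ = ≤-trans (s≤s (chainLength-bound invα c)) α₁<τ₁

proposition5p15 : ∀ (la τ μ : Defs.Pair) → Triangular la → Sub la τ → RightSide la τ → Sub la μ → la ⊢ τ ≼ μ →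
    RightSide la μ × proj₁ μ ≤ proj₁ τ × Dist la τ μ (proj₁ τ ∸ proj₁ μ)
proposition5p15 la τ μ _ subτ rsτ _ τ≼μ with ≼⇒chain (subτ , rsτ) τ≼μ
... | (_ , rsμ) , c , len≡ =
  rsμ , subst (proj₁ μ ≤_) len≡ (m≤n+m _ _) ,
  (c , trans (sym (m+n∸n≡m _ (proj₁ μ))) (cong (_∸ proj₁ μ) len≡)) ,
  λ c′ → m+n≤o⇒m≤o∸n (chainLength c′) (chainLength-bound (subτ , rsτ) c′)
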